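{- For every $i\in\{1,\dots,m\}$, every request $r\in X_i^*$ belongs to $Y_w$ for some $w\in\{1,\dots,i-1\}$, and this $w$ is unique.
   Context: Fix an instance of ROLDARP: a complete undirected graph with positive edge weights (travel times), an origin, a time limit $T$, an integer $f$ with $1<f<T$ and all edge weights at most $T/f$, and requests $(s,d,t,p)$ (source, destination, release time, revenue) revealed online at their release times; a unit-capacity non-preemptive server starting at the origin at time $0$ serves a request by travelling to $s$ and then to $d$, leaving $s$ no earlier than $t$, and earns $p$ if it completes by time $T$. Each request is served at most once. $\mathrm{OPT}$ is an optimal offline schedule. Time is split into segments $t_1,\dots,t_f$ of length $T/f$ ($t_j$ ends at $jT/f$), and window $i$ consists of segments $t_{2i-1},t_{2i}$. Algorithm SBP: if $f$ is odd it idles during $t_1$ and sets $i=2$, else $i=1$; while $i<f$, at the start of $t_i$ it computes, among released unserved requests, a maximum-total-revenue sequence of requests servable consecutively within time $T/f$ starting at the source of the first, moves to that source during $t_i$ and serves the sequence during $t_{i+1}$ (idling if no request is available), then increases $i$ by $2$. Let $m=\lceil f/2\rceil-1$. For $i=1,\dots,m$: $S'_i$ is the set of requests that SBP serves in window $i+1$ (so $S'_i$ is the SBP schedule shifted one window earlier); $S_i^*$ is the set of requests that $\mathrm{OPT}$ completes during whichever of $t_{2i-1},t_{2i}$ has larger $\mathrm{OPT}$ revenue. Define $X_i^*=\{r\in S_i^*: r\in S'_w \text{ for some } w\in\{1,\dots,i-1\}\}$ and $Y_i=\{r\in S'_i: r\notin S_w^* \text{ for all } w\in\{1,\dots,i\}\}$.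 -}

module Defs where

open import Data.Bool using (Bool; true; false; if_then_else_; _∧_)
open import Data.Nat as ℕ using (ℕ; zero; suc; _∸_; z<s; s<s)
import Data.Nat.Properties as ℕP
open import Data.Nat.DivMod using (_/_; _%_)
open import Data.Fin using (Fin)
open import Data.Integer using (+_)
open import Data.Rational as ℚ using (ℚ; 0ℚ; _≤_; _<_; _+_; _*_; _≤ᵇ_)
open import Data.List using (List; []; _∷_; map; upTo; sum)
open import Data.List.Membership.Propositional using (_∈_; _∉_)
open import Data.List.Relation.Unary.All using (All)
open import Data.List.Relation.Unary.Any using (Any)
open import Data.List.Relation.Unary.Unique.Propositional using (Unique)
open import Data.Product using (Σ; ∃; _×_; _,_; proj₁; proj₂)
open import Relation.Binary.PropositionalEquality using (_≡_)
open import Relation.Nullary using (¬_)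
open import Relation.Nullary.Decidable using (⌊_⌋)

ℕ→ℚ : ℕ → ℚ
ℕ→ℚ n = (+ n) ℚ./ 1

open import Data.Sum using (_⊎_)

segLen : ℚ → (f : ℕ) → 1 ℕ.< f → ℚ
segLen T f 1<f = T * ℚ._/_ (+ 1) f {{ℕ.>-nonZero (ℕP.<-trans z<s 1<f)}}

record Request (n : ℕ) : Set where
  field
    src : Fin n
    dst : Fin n
    rel : ℚ      -- release time t
    rev : ℚ      -- revenue p

record Instance : Set where
  field
    n        : ℕ
    k        : ℕ
    origin   : Fin n
    dist     : Fin n → Fin n → ℚ        -- edge weights of the complete graph
    dist-pos : ∀ x y → ¬ x ≡ y → 0ℚ < dist x y
    dist-sym : ∀ x y → dist x y ≡ dist y x
    dist-refl : ∀ x → dist x x ≡ 0ℚ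
    T        : ℚ
    f        : ℕ
    1<f      : 1 ℕ.< f
    f<T      : ℕ→ℚ f < T
    req      : Fin k → Request n
    rel-nonneg : ∀ j → 0ℚ ≤ Request.rel (req j)
    rev-nonneg : ∀ j → 0ℚ ≤ Request.rev (req j)
    dist-≤   : ∀ x y → dist x y ≤ segLen T f 1<f

  src : Fin k → Fin n
  src j = Request.src (req j)
  dst : Fin k → Fin n
  dst j = Request.dst (req j)
  relT : Fin k → ℚ
  relT j = Request.rel (req j)
  revP : Fin k → ℚ
  revP j = Request.rev (req j)

  δ : ℚ
  δ = segLen T f 1<f

  segEnd : ℕ → ℚ
  segEnd j = ℕ→ℚ j * δ

  InSeg : ℕ → ℚ → Set
  InSeg j c = segEnd (j ∸ 1) < c × c ≤ segEnd j

  inSegᵇ : ℕ → ℚ → Bool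
  inSegᵇ j c = ⌊ segEnd (j ∸ 1) ℚ.<? c ⌋ ∧ (c ≤ᵇ segEnd j)

  InWindow : ℕ → ℚ → Set
  InWindow w c = InSeg (2 ℕ.* w ∸ 1) c ⊎ InSeg (2 ℕ.* w) c

  m : ℕ
  m = (f ℕ.+ 1) / 2 ∸ 1

  -- Schedules.  An event (j , c) means request j is completed at time c.
  Event : Set
  Event = Fin k × ℚ

  revenue : List Event → ℚ
  revenue [] = 0ℚ
  revenue ((j , c) ∷ es) = (if c ≤ᵇ T then revP j else 0ℚ) + revenue es

  segRevenue : ℕ → List Event → ℚ
  segRevenue j [] = 0ℚ
  segRevenue j ((r , c) ∷ es) = (if inSegᵇ j c then revP r else 0ℚ) + segRevenue j es

  data Action : Set where
    wait  : ℚ → Action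
    move  : Fin n → Action
    serve : Fin k → Action      -- pick up request at its source, carry it to its destination

  -- Exec x τ S as es : starting at vertex x at time τ, with the requests in S
  -- already served, executing the actions as is feasible and yields completions es.
  data Exec : Fin n → ℚ → List (Fin k) → List Action → List Event → Set where
    done  : ∀ {x τ S} → Exec x τ S [] []
    wait  : ∀ {x τ S as es} (Δ : ℚ) → 0ℚ ≤ Δ → Exec x (τ + Δ) S as es →
            Exec x τ S (wait Δ ∷ as) es
    move  : ∀ {x τ S as es} (y : Fin n) → Exec y (τ + dist x y) S as es →
            Exec x τ S (move y ∷ as) es
    serve : ∀ {x τ S as es} (j : Fin k) → x ≡ src j → relT j ≤ τ → j ∉ S →
            Exec (dst j) (τ + dist (src j) (dst j)) (j ∷ S) as es →
            Exec x τ S (serve j ∷ as) ((j , τ + dist (src j) (dst j)) ∷ es)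

  Feasible : List Action → List Event → Set
  Feasible as es = Exec origin 0ℚ [] as es

  IsOPT : List Action → List Event → Set
  IsOPT as es = Feasible as es ×
    (∀ as' es' → Feasible as' es' → revenue es' ≤ revenue es)

  -- time to serve a sequence consecutively, starting at the source of the first
  chainTime : List (Fin k) → ℚ
  chainTime [] = 0ℚ
  chainTime (r ∷ []) = dist (src r) (dst r)
  chainTime (r ∷ r' ∷ rs) = dist (src r) (dst r) + dist (dst r) (src r') + chainTime (r' ∷ rs)

  seqRevenue : List (Fin k) → ℚ
  seqRevenue [] = 0ℚ
  seqRevenue (r ∷ rs) = revP r + seqRevenue rs

  Admissible : ℕ → List (Fin k) → List (Fin k) → Set
  Admissible i served rs =
    All (λ r → relT r ≤ segEnd (i ∸ 1)) rs × All (λ r → r ∉ served) rs ×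
    Unique rs × chainTime rs ≤ δ

  OptimalChoice : ℕ → List (Fin k) → List (Fin k) → Set
  OptimalChoice i served rs = Admissible i served rs ×
    (∀ rs' → Admissible i served rs' → seqRevenue rs' ≤ seqRevenue rs)

  serveFrom : ℚ → Fin n → List (Fin k) → List Event
  serveFrom τ x [] = []
  serveFrom τ x (r ∷ rs) =
    let c = τ + dist x (src r) + dist (src r) (dst r) in (r , c) ∷ serveFrom c (dst r) rs

  -- serving the chosen sequence during t_{i+1}, starting at time iT/f at the first source
  phaseEvents : ℕ → List (Fin k) → List Event
  phaseEvents i [] = []
  phaseEvents i (r ∷ rs) = serveFrom (segEnd i) (src r) (r ∷ rs)

  lastPos : Fin n → List (Fin k) → Fin n
  lastPos x [] = x
  lastPos x (r ∷ rs) = lastPos (dst r) rs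

  -- the values of i at which SBP starts a phase:
  -- f even: 1,3,...,f-1 ; f odd: 2,4,...,f-1
  phaseStarts : List ℕ
  phaseStarts = map (λ j → 2 ℕ.* j ℕ.+ 1 ℕ.+ f % 2) (upTo (f / 2))

  -- SBPRun x served is es : a run of SBP (ties in the maximisation resolved arbitrarily)
  -- through the remaining phases is, yielding completion events es
  data SBPRun : Fin n → List (Fin k) → List ℕ → List Event → Set where
    done : ∀ {x served} → SBPRun x served [] []
    step : ∀ {x served i is es} (rs : List (Fin k)) → OptimalChoice i served rs →
           SBPRun (lastPos x rs) (served Data.List.++ rs) is es →
           SBPRun x served (i ∷ is) (phaseEvents i rs Data.List.++ es)

  IsSBP : List Event → Set
  IsSBP es = SBPRun origin [] phaseStarts es

  -- S'_i : requests SBP serves (completes) in window i+1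
  S′ : List Event → ℕ → Fin k → Set
  S′ sbp i r = Any (λ e → proj₁ e ≡ r × InWindow (suc i) (proj₂ e)) sbp

  -- segment of window i with larger OPT revenue (ties: t_{2i-1})
  bestSeg : List Event → ℕ → ℕ
  bestSeg opt i = if segRevenue (2 ℕ.* i) opt ≤ᵇ segRevenue (2 ℕ.* i ∸ 1) opt
                  then 2 ℕ.* i ∸ 1 else 2 ℕ.* i

  S* : List Event → ℕ → Fin k → Set
  S* opt i r = Any (λ e → proj₁ e ≡ r × InSeg (bestSeg opt i) (proj₂ e)) opt

  X* : List Event → List Event → ℕ → Fin k → Set
  X* opt sbp i r = S* opt i r × Σ ℕ (λ w → 1 ℕ.≤ w × w ℕ.< i × S′ sbp w r)

  Y : List Event → List Event → ℕ → Fin k → Set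
  Y opt sbp i r = S′ sbp i r × (∀ w → 1 ℕ.≤ w → w ℕ.≤ i → ¬ S* opt w r)

-- The argument rests on two facts.
--   * Every schedule completes each request at most once: the requests of the
--     completion events of a feasible OPT schedule, and of a run of SBP, form a
--     duplicate-free list.  Both are proved from one invariant, "the requests
--     completed from now on are distinct and were not served before" (Fresh).
--   * Windows are disjoint in time: a completion time lying in windows a and b
--     forces a ≡ b.  This follows from the monotonicity of the segment ends
--     jT/f, and the segment chosen for S*_v is one of the two segments of
--     window v.
-- If r ∈ X*_i, then r ∈ S′_w for some w < i.  Since OPT completes r only once,
-- inside window i, r lies in no S*_v with v ≤ w; hence r ∈ Y_w.  Since SBP
-- completes r only once, r lies in S′_w′ for no other w′, which gives uniqueness.
module Submission where

open import Defs
open import Data.Nat using (ℕ; _≤_; _<_)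
open import Data.Fin using (Fin)
open import Data.List using (List)
open import Data.Product using (Σ; _×_)
open import Relation.Binary.PropositionalEquality using (_≡_)

import Data.Nat as ℕ
import Data.Nat.Properties as ℕP
import Data.Nat.Divisibility as ℕD
import Data.Integer as ℤ
import Data.Integer.Properties as ℤP
import Data.Rational as ℚ
import Data.Rational.Properties as ℚP
open import Data.Bool using (true; false; if_then_else_)
open import Data.Product using (∃; _,_; proj₁; proj₂)
open import Data.Sum using (_⊎_; inj₁; inj₂)
open import Data.Empty using (⊥-elim)
open import Data.List using ([]; _∷_; _++_; map)
open import Data.List.Properties using (map-++)
open import Data.List.Relation.Unary.All as All using (All; []; _∷_)
import Data.List.Relation.Unary.All.Properties as AllP
open import Data.List.Relation.Unary.Any using (Any; here; there)
open import Data.List.Relation.Unary.Unique.Propositional using (Unique)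
open import Data.List.Relation.Unary.AllPairs using ([]; _∷_)
import Data.List.Relation.Unary.Unique.Propositional.Properties as UniqueP
open import Data.List.Membership.Propositional using (_∉_)
open import Data.List.Membership.Propositional.Properties using (∈-++⁺ˡ; ∈-++⁺ʳ)
open import Relation.Binary using (tri<; tri≈; tri>)
open import Relation.Binary.PropositionalEquality using (_≢_; refl; sym; trans; cong; subst; subst₂; module ≡-Reasoning)
open import Relation.Nullary using (¬_)

module _ {A : Set} where

  Fresh : List A → List A → Set
  Fresh S xs = Unique xs × All (_∉ S) xs

  fresh-∷ : ∀ {x S xs} → x ∉ S → Fresh (x ∷ S) xs → Fresh S (x ∷ xs)
  fresh-∷ x∉S (unique , avoid) =
      All.map (λ y∉xS x≡y → y∉xS (here (sym x≡y))) avoid ∷ unique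
    , x∉S ∷ All.map (λ y∉xS y∈S → y∉xS (there y∈S)) avoid

  fresh-++ : ∀ {S ys xs} → Unique ys → All (_∉ S) ys → Fresh (S ++ ys) xs →
             Fresh S (ys ++ xs)
  fresh-++ {S} {ys} ys-unique ys-avoid (unique , avoid) =
      UniqueP.++⁺ ys-unique unique
        (λ (y∈ys , y∈xs) → All.lookup avoid y∈xs (∈-++⁺ʳ S y∈ys))
    , AllP.++⁺ ys-avoid (All.map (λ x∉Sys x∈S → x∉Sys (∈-++⁺ˡ x∈S)) avoid)

  key-absent : {E : Set} {key : E → A} {k r : A} {R : E → Set} {es : List E} →
               All (k ≢_) (map key es) → k ≡ r → ¬ Any (λ e → key e ≡ r × R e) es
  key-absent distinct k≡r any with All.lookupAny (AllP.map⁻ distinct) any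
  ... | k≢e , e≡r , _ = k≢e (trans k≡r (sym e≡r))

  same-key : {E : Set} {key : E → A} {r : A} {P Q : E → Set} {es : List E} →
             Unique (map key es) →
             Any (λ e → key e ≡ r × P e) es → Any (λ e → key e ≡ r × Q e) es →
             ∃ λ e → P e × Q e
  same-key _ (here (_ , p)) (here (_ , q)) = _ , p , q
  same-key (distinct ∷ _) (here (e≡r , _)) (there q) = ⊥-elim (key-absent distinct e≡r q)
  same-key (distinct ∷ _) (there p) (here (e≡r , _)) = ⊥-elim (key-absent distinct e≡r p)
  same-key (_ ∷ unique) (there p) (there q) = same-key unique p q

if-either : ∀ {A : Set} (P : A → Set) b {x y : A} → P (if b then x else y) → P x ⊎ P y
if-either P true = inj₁
if-either P false = inj₂

ℕ→ℚ-mono : ∀ {a b} → a ≤ b → ℕ→ℚ a ℚ.≤ ℕ→ℚ b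
ℕ→ℚ-mono {a} {b} a≤b
  rewrite ℚP.normalize-coprime {a} {0} (λ (_ , d∣1) → ℕD.∣1⇒≡1 d∣1)
        | ℚP.normalize-coprime {b} {0} (λ (_ , d∣1) → ℕD.∣1⇒≡1 d∣1)
  = ℚ.*≤* (subst₂ ℤ._≤_ (sym (ℤP.*-identityʳ (ℤ.+ a))) (sym (ℤP.*-identityʳ (ℤ.+ b)))
                    (ℤ.+≤+ a≤b))

-- Window a ends (segment 2a) strictly before window b > a starts (segment 2b-1).
double-gap : ∀ {a b} → a < b → 2 ℕ.* a < 2 ℕ.* b ℕ.∸ 1
double-gap {a} {b} a<b = ℕP.∸-monoˡ-≤ 1
  (subst (_≤ 2 ℕ.* b) (ℕP.*-suc 2 a) (ℕP.*-monoʳ-≤ 2 a<b))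

module _ (I : Instance) where
  open Instance I

  requests : List Event → List (Fin k)
  requests = map proj₁

  serveFrom-requests : ∀ τ x rs → requests (serveFrom τ x rs) ≡ rs
  serveFrom-requests τ x [] = refl
  serveFrom-requests τ x (r ∷ rs) = cong (r ∷_) (serveFrom-requests _ (dst r) rs)

  phaseEvents-requests : ∀ i rs → requests (phaseEvents i rs) ≡ rs
  phaseEvents-requests i [] = refl
  phaseEvents-requests i (r ∷ rs) = serveFrom-requests (segEnd i) (src r) (r ∷ rs)

  exec-fresh : ∀ {x τ S as es} → Exec x τ S as es → Fresh S (requests es)
  exec-fresh done = [] , []
  exec-fresh (wait _ _ exec) = exec-fresh exec
  exec-fresh (move _ exec) = exec-fresh exec
  exec-fresh (serve _ _ _ j∉S exec) = fresh-∷ j∉S (exec-fresh exec)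

  -- Likewise for a run of SBP: every phase serves an admissible sequence,
  -- which is duplicate-free and avoids the requests served so far.
  sbp-fresh : ∀ {x served is es} → SBPRun x served is es → Fresh served (requests es)
  sbp-fresh done = [] , []
  sbp-fresh {served = served} (step {i = i} {es = es} rs ((_ , avoid , unique , _) , _) run) =
    subst (Fresh served) (sym completed) (fresh-++ unique avoid (sbp-fresh run))
    where
    completed : requests (phaseEvents i rs ++ es) ≡ rs ++ requests es
    completed = begin
      requests (phaseEvents i rs ++ es)               ≡⟨ map-++ proj₁ (phaseEvents i rs) es ⟩
      requests (phaseEvents i rs) ++ requests es      ≡⟨ cong (_++ requests es) (phaseEvents-requests i rs) ⟩
      rs ++ requests es                               ∎
      where open ≡-Reasoning

  -- the segment length T/f is nonnegative, since T > f > 0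
  δ-nonneg : ℚ.0ℚ ℚ.≤ δ
  δ-nonneg = ℚP.nonNegative⁻¹ δ
    {{ℚP.nonNeg*nonNeg⇒nonNeg T {{T-nonneg}} _
      {{ℚP.normalize-nonNeg 1 f {{ℕ.>-nonZero (ℕP.<-trans ℕ.z<s 1<f)}}}}}}
    where
    T-nonneg = ℚ.nonNegative (ℚP.<⇒≤ (ℚP.≤-<-trans (ℕ→ℚ-mono {0} {f} ℕ.z≤n) f<T))

  segEnd-mono : ∀ {a b} → a ≤ b → segEnd a ℚ.≤ segEnd b
  segEnd-mono a≤b = ℚP.*-monoʳ-≤-nonNeg δ {{ℚ.nonNegative δ-nonneg}} (ℕ→ℚ-mono a≤b)

  segments-ordered : ∀ {j j′ c} → j < j′ → InSeg j c → ¬ InSeg j′ c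
  segments-ordered j<j′ (_ , c≤end) (start<c , _) =
    ℚP.<-irrefl refl (ℚP.≤-<-trans (ℚP.≤-trans c≤end (segEnd-mono (ℕP.∸-monoˡ-≤ 1 j<j′))) start<c)

  window-upper : ∀ {a c} → InWindow a c → ∃ λ j → j ≤ 2 ℕ.* a × InSeg j c
  window-upper {a} (inj₁ seg) = _ , ℕP.m∸n≤m (2 ℕ.* a) 1 , seg
  window-upper (inj₂ seg) = _ , ℕP.≤-refl , seg

  window-lower : ∀ {a c} → InWindow a c → ∃ λ j → 2 ℕ.* a ℕ.∸ 1 ≤ j × InSeg j c
  window-lower (inj₁ seg) = _ , ℕP.≤-refl , seg
  window-lower {a} (inj₂ seg) = _ , ℕP.m∸n≤m (2 ℕ.* a) 1 , seg

  windows-ordered : ∀ {a b c} → a < b → InWindow a c → ¬ InWindow b c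
  windows-ordered {a} {b} {c} a<b in-a in-b with window-upper {a} in-a | window-lower {b} in-b
  ... | j , j≤2a , seg | j′ , 2b-1≤j′ , seg′ =
    segments-ordered {j} {j′} {c} (ℕP.≤-<-trans j≤2a (ℕP.<-≤-trans (double-gap a<b) 2b-1≤j′)) seg seg′

  window-unique : ∀ {a b c} → InWindow a c → InWindow b c → a ≡ b
  window-unique {a} {b} in-a in-b with ℕP.<-cmp a b
  ... | tri< a<b _ _ = ⊥-elim (windows-ordered a<b in-a in-b)
  ... | tri≈ _ a≡b _ = a≡b
  ... | tri> _ _ b<a = ⊥-elim (windows-ordered b<a in-b in-a)

  bestSeg-in-window : ∀ opt v {c} → InSeg (bestSeg opt v) c → InWindow v c
  bestSeg-in-window opt v {c} = if-either (λ j → InSeg j c)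
    (segRevenue (2 ℕ.* v) opt ℚ.≤ᵇ segRevenue (2 ℕ.* v ℕ.∸ 1) opt)

  S*-unique : ∀ {opt v i r} → Unique (requests opt) → S* opt v r → S* opt i r → v ≡ i
  S*-unique {opt} {v} {i} unique in-v in-i =
    let (_ , seg-v , seg-i) = same-key {key = proj₁}
          {P = λ e → InSeg (bestSeg opt v) (proj₂ e)} {Q = λ e → InSeg (bestSeg opt i) (proj₂ e)}
          unique in-v in-i
    in window-unique (bestSeg-in-window opt v seg-v) (bestSeg-in-window opt i seg-i)

  S′-unique : ∀ {sbp w w′ r} → Unique (requests sbp) → S′ sbp w r → S′ sbp w′ r → w ≡ w′
  S′-unique {w = w} {w′} unique in-w in-w′ =
    let (_ , win , win′) = same-key {key = proj₁}
          {P = λ e → InWindow (ℕ.suc w) (proj₂ e)} {Q = λ e → InWindow (ℕ.suc w′) (proj₂ e)}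
          unique in-w in-w′
    in ℕP.suc-injective (window-unique win win′)

lemma4 : (I : Instance) → let open Instance I in
         (acts : List Action) (opt sbp : List Event) → IsOPT acts opt → IsSBP sbp →
         (i : ℕ) → 1 ≤ i → i ≤ m → (r : Fin k) → X* opt sbp i r →
         Σ ℕ (λ w → (1 ≤ w × w < i × Y opt sbp w r) ×
                    ((w′ : ℕ) → 1 ≤ w′ → w′ < i → Y opt sbp w′ r → w′ ≡ w))
lemma4 I acts opt sbp (feasible , _) run i _ _ r (in-S*ᵢ , w , 1≤w , w<i , in-S′w) =
  w , (1≤w , w<i , in-S′w , not-in-earlier-S*) , only-w
  where
  opt-once : Unique (requests I opt)
  opt-once = proj₁ (exec-fresh I feasible)

  sbp-once : Unique (requests I sbp)
  sbp-once = proj₁ (sbp-fresh I run)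

  -- OPT completes r in window i, hence in no window v ≤ w < i.
  not-in-earlier-S* : ∀ v → 1 ≤ v → v ≤ w → ¬ Instance.S* I opt v r
  not-in-earlier-S* v _ v≤w in-S*ᵥ =
    ℕP.<-irrefl (S*-unique I {opt} {v} {i} {r} opt-once in-S*ᵥ in-S*ᵢ) (ℕP.≤-<-trans v≤w w<i)

  only-w : ∀ w′ → 1 ≤ w′ → w′ < i → Instance.Y I opt sbp w′ r → w′ ≡ w
  only-w w′ _ _ (in-S′w′ , _) = S′-unique I {sbp} {w′} {w} {r} sbp-once in-S′w′ in-S′w
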